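{- Let $E=(d_1,\ldots,d_{m-1})$ be a valid ordered tuple and $d=d_1+\cdots+d_{m-1}$. Let $B_E$ be the set of nonnegative integers whose base $d+1$ representation contains only the digits $0$ and $1$. Then there do not exist $x_1,\ldots,x_m\in B_E$, not all the same, with $d_1x_1+\cdots+d_{m-1}x_{m-1}=dx_m$.
   Context: An ordered tuple $E=(d_1,\ldots,d_{m-1})$ of positive integers is written in nondecreasing order; $E$ is valid if $d_1=1$ and $d_l\le d_1+\cdots+d_{l-1}$ for every $2\le l\le m-1$. -}

module Defs where

open import Data.Nat using (ℕ; zero; suc; _+_; _*_; _≤_)
open import Data.Fin as Fin using (Fin; toℕ)
open import Data.Vec using (Vec; lookup; toList)
import Data.List as List
open import Data.Product using (_×_)
open import Data.Nat.ListAction using (sum)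
open import Relation.Binary.PropositionalEquality using (_≡_)

prefixSum : ∀ {k} → Vec ℕ k → ℕ → ℕ
prefixSum E l = sum (List.take l (toList E))

-- E = (d_1, ..., d_{k}) (here k = m - 1, 0-indexed entries) is an
-- ordered tuple of positive integers, written in nondecreasing order,
-- which is valid: d_1 = 1 and d_l ≤ d_1 + ... + d_{l-1} for 2 ≤ l ≤ k.
Valid : ∀ {n} → Vec ℕ (suc n) → Set
Valid {n} E =
  (∀ i → 1 ≤ lookup E i)
  × (∀ (i j : Fin (suc n)) → i Fin.≤ j → lookup E i ≤ lookup E j)
  × (lookup E Fin.zero ≡ 1)
  × (∀ (l : Fin (suc n)) → 1 ≤ toℕ l → lookup E l ≤ prefixSum E (toℕ l))

-- x has a base-b representation using only the digits 0 and 1: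
-- x = ε₀ + b·(ε₁ + b·(ε₂ + ...)) with every εᵢ ∈ {0,1}.
-- (For b ≥ 2 this is exactly: all digits of the base-b expansion are 0 or 1.)
data Digits01 (b : ℕ) : ℕ → Set where
  nil  : Digits01 b 0
  cons : ∀ {y} (ε : ℕ) → ε ≤ 1 → Digits01 b y → Digits01 b (ε + b * y)

B : ∀ {n} → Vec ℕ (suc n) → ℕ → Set
B E x = Digits01 (suc (sum (toList E))) x

module Submission where

-- Put D = d₁ + ⋯ + d_{m-1} and b = D + 1.
-- Write every xᵢ and x_m as (lowest digit) + b·(rest), with lowest digits
-- εᵢ, ε ∈ {0,1}.  Since Σ dᵢεᵢ ≤ D < b and Dε ≤ D < b, the equation
--   Σ dᵢ xᵢ = D x_m
-- splits, by uniqueness of division with remainder by b, into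
--   Σ dᵢ εᵢ = D ε     and     Σ dᵢ yᵢ = D y_m   for the rests.
-- A weighted sum of 0/1 entries with positive weights equals 0 only if all
-- entries are 0, and equals the total weight D only if all entries are 1;
-- hence εᵢ = ε for all i.  Induction on the digits of x_m then gives xᵢ = x_m
-- for all i, contradicting the hypothesis that the xᵢ are not all equal to x_m.

open import Defs
open import Data.Nat using (ℕ; suc; _+_; _*_; _≤_; _<_; z≤n; s≤s; NonZero; >-nonZero)
open import Data.Nat.Properties
open import Data.Nat.DivMod using (_%_; [m+kn]%n≡m%n; m<n⇒m%n≡m)
open import Data.Nat.ListAction using (sum)
open import Data.Nat.Tactic.RingSolver using (solve-∀)
import Data.Fin as Fin
open import Data.Vec using (Vec; []; _∷_; lookup; toList; zipWith; tabulate)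
open import Data.Vec.Properties using (lookup∘tabulate)
open import Data.Product using (_×_; _,_; proj₁; proj₂)
open import Relation.Binary.PropositionalEquality
open import Relation.Nullary using (¬_)

total : ∀ {k} → Vec ℕ k → ℕ
total E = sum (toList E)

weightedSum : ∀ {k} → Vec ℕ k → Vec ℕ k → ℕ
weightedSum E xs = sum (toList (zipWith _*_ E xs))

Positive : ∀ {k} → Vec ℕ k → Set
Positive E = ∀ i → 1 ≤ lookup E i

positive-tail : ∀ {k d} {E : Vec ℕ k} → Positive (d ∷ E) → Positive E
positive-tail pos i = pos (Fin.suc i)

digits-unique : ∀ {b a a′ c c′} .{{_ : NonZero b}} → a < b → a′ < b →
  a + b * c ≡ a′ + b * c′ → a ≡ a′ × c ≡ c′
digits-unique {b} {a} {a′} {c} {c′} a<b a′<b eq = low , high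
  where
  low : a ≡ a′
  low = begin
    a                  ≡⟨ m<n⇒m%n≡m a<b ⟨
    a % b              ≡⟨ [m+kn]%n≡m%n a c b ⟨
    (a + c * b) % b    ≡⟨ cong (λ t → (a + t) % b) (*-comm c b) ⟩
    (a + b * c) % b    ≡⟨ cong (_% b) eq ⟩
    (a′ + b * c′) % b  ≡⟨ cong (λ t → (a′ + t) % b) (*-comm b c′) ⟩
    (a′ + c′ * b) % b  ≡⟨ [m+kn]%n≡m%n a′ c′ b ⟩
    a′ % b             ≡⟨ m<n⇒m%n≡m a′<b ⟩
    a′                 ∎
    where open ≡-Reasoning
  high : c ≡ c′
  high = *-cancelˡ-≡ c c′ b (+-cancelˡ-≡ a _ _ (trans eq (cong (_+ b * c′) (sym low))))

bounded-sum-split : ∀ {a b c d} → a ≤ c → b ≤ d → a + b ≡ c + d → a ≡ c × b ≡ d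
bounded-sum-split {a} {b} {c} {d} a≤c b≤d eq = a≡c , +-cancelˡ-≡ c b d (subst (λ t → t + b ≡ c + d) a≡c eq)
  where
  a≡c : a ≡ c
  a≡c = ≤-antisym a≤c (+-cancelʳ-≤ d c a (subst (_≤ a + d) eq (+-monoʳ-≤ a b≤d)))

weightedSum-≤ : ∀ {k c} (E xs : Vec ℕ k) → (∀ i → lookup xs i ≤ c) →
  weightedSum E xs ≤ total E * c
weightedSum-≤ [] [] _ = z≤n
weightedSum-≤ {c = c} (d ∷ E) (x ∷ xs) x≤c =
  ≤-trans (+-mono-≤ (*-monoʳ-≤ d (x≤c Fin.zero)) (weightedSum-≤ E xs (λ i → x≤c (Fin.suc i))))
          (≤-reflexive (sym (*-distribʳ-+ c d (total E))))

weightedSum-zero : ∀ {k} (E xs : Vec ℕ k) → Positive E →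
  weightedSum E xs ≡ 0 → ∀ i → lookup xs i ≡ 0
weightedSum-zero (d ∷ E) (x ∷ xs) pos eq Fin.zero =
  m*n≡0⇒m≡0 x d {{>-nonZero (pos Fin.zero)}} (trans (*-comm x d) (m+n≡0⇒m≡0 (d * x) eq))
weightedSum-zero (d ∷ E) (x ∷ xs) pos eq (Fin.suc i) =
  weightedSum-zero E xs (positive-tail pos) (m+n≡0⇒n≡0 (d * x) eq) i

weightedSum-max : ∀ {k c} (E xs : Vec ℕ k) → Positive E → (∀ i → lookup xs i ≤ c) →
  weightedSum E xs ≡ total E * c → ∀ i → lookup xs i ≡ c
weightedSum-max {c = c} (d ∷ E) (x ∷ xs) pos x≤c eq i
  with bounded-sum-split (*-monoʳ-≤ d (x≤c Fin.zero))
         (weightedSum-≤ E xs (λ j → x≤c (Fin.suc j)))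
         (trans eq (*-distribʳ-+ c d (total E)))
weightedSum-max (d ∷ E) (x ∷ xs) pos x≤c eq Fin.zero | head , _ =
  *-cancelˡ-≡ x _ d {{>-nonZero (pos Fin.zero)}} head
weightedSum-max (d ∷ E) (x ∷ xs) pos x≤c eq (Fin.suc i) | _ , rest =
  weightedSum-max E xs (positive-tail pos) (λ j → x≤c (Fin.suc j)) rest i

weightedSum-01 : ∀ {k ε} (E es : Vec ℕ k) → Positive E → (∀ i → lookup es i ≤ 1) →
  ε ≤ 1 → weightedSum E es ≡ total E * ε → ∀ i → lookup es i ≡ ε
weightedSum-01 E es pos _ z≤n eq = weightedSum-zero E es pos (trans eq (*-zeroʳ (total E)))
weightedSum-01 E es pos es≤1 (s≤s z≤n) eq = weightedSum-max E es pos es≤1 eq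

scaled-digit-≤ : ∀ D {ε} → ε ≤ 1 → D * ε ≤ D
scaled-digit-≤ D z≤n = ≤-trans (≤-reflexive (*-zeroʳ D)) z≤n
scaled-digit-≤ D (s≤s z≤n) = ≤-reflexive (*-identityʳ D)

weightedSum-linear : ∀ {k} b (E xs es ys : Vec ℕ k) →
  (∀ i → lookup xs i ≡ lookup es i + b * lookup ys i) →
  weightedSum E xs ≡ weightedSum E es + b * weightedSum E ys
weightedSum-linear b [] [] [] [] _ = sym (*-zeroʳ b)
weightedSum-linear b (d ∷ E) (x ∷ xs) (e ∷ es) (y ∷ ys) split
  rewrite split Fin.zero | weightedSum-linear b E xs es ys (λ i → split (Fin.suc i)) =
  regroup b d e y (weightedSum E es) (weightedSum E ys)
  where
  regroup : ∀ b d e y s t → d * (e + b * y) + (s + b * t) ≡ d * e + s + b * (d * y + t)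
  regroup = solve-∀

lowDigit : ∀ {b x} → Digits01 b x → ℕ
lowDigit nil = 0
lowDigit (cons ε _ _) = ε

highPart : ∀ {b x} → Digits01 b x → ℕ
highPart nil = 0
highPart (cons {y} _ _ _) = y

lowDigit≤1 : ∀ {b x} (p : Digits01 b x) → lowDigit p ≤ 1
lowDigit≤1 nil = z≤n
lowDigit≤1 (cons _ ε≤1 _) = ε≤1

highPart-digits : ∀ {b x} (p : Digits01 b x) → Digits01 b (highPart p)
highPart-digits nil = nil
highPart-digits (cons _ _ q) = q

digit-split : ∀ {b x} (p : Digits01 b x) → x ≡ lowDigit p + b * highPart p
digit-split {b} nil = sym (*-zeroʳ b)
digit-split (cons _ _ _) = refl

weighted-digits-rigid : ∀ {k} (E : Vec ℕ k) → Positive E → (xs : Vec ℕ k) {xm : ℕ} →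
  (∀ i → Digits01 (suc (total E)) (lookup xs i)) → Digits01 (suc (total E)) xm →
  weightedSum E xs ≡ total E * xm → ∀ i → lookup xs i ≡ xm
weighted-digits-rigid E pos xs hx nil eq =
  weightedSum-zero E xs pos (trans eq (*-zeroʳ (total E)))
weighted-digits-rigid E pos xs hx (cons {ym} ε ε≤1 dym) eq i =
  begin
    lookup xs i                          ≡⟨ xs-split i ⟩
    lookup es i + b * lookup ys i        ≡⟨ cong₂ (λ u v → u + b * v) (lows-agree i) (highs-agree i) ⟩
    ε + b * ym                           ∎
  where
  open ≡-Reasoning
  D b : ℕ
  D = total E
  b = suc D
  es ys : Vec ℕ _
  es = tabulate (λ j → lowDigit (hx j))
  ys = tabulate (λ j → highPart (hx j))

  xs-split : ∀ j → lookup xs j ≡ lookup es j + b * lookup ys j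
  xs-split j rewrite lookup∘tabulate (λ j → lowDigit (hx j)) j
                   | lookup∘tabulate (λ j → highPart (hx j)) j = digit-split (hx j)

  es≤1 : ∀ j → lookup es j ≤ 1
  es≤1 j rewrite lookup∘tabulate (λ j → lowDigit (hx j)) j = lowDigit≤1 (hx j)

  ys-digits : ∀ j → Digits01 b (lookup ys j)
  ys-digits j rewrite lookup∘tabulate (λ j → highPart (hx j)) j = highPart-digits (hx j)

  split-eq : weightedSum E es + b * weightedSum E ys ≡ D * ε + b * (D * ym)
  split-eq = begin
    weightedSum E es + b * weightedSum E ys  ≡⟨ weightedSum-linear b E xs es ys xs-split ⟨
    weightedSum E xs                         ≡⟨ eq ⟩
    D * (ε + b * ym)                         ≡⟨ *-distribˡ-+ D ε (b * ym) ⟩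
    D * ε + D * (b * ym)                     ≡⟨ cong (D * ε +_) (*-comm-middle D b ym) ⟩
    D * ε + b * (D * ym)                     ∎
    where
    *-comm-middle : ∀ x y z → x * (y * z) ≡ y * (x * z)
    *-comm-middle = solve-∀

  -- both lowest digits are < b since they are at most D
  split-parts : weightedSum E es ≡ D * ε × weightedSum E ys ≡ D * ym
  split-parts = digits-unique {b = b}
    (s≤s (≤-trans (weightedSum-≤ E es es≤1) (≤-reflexive (*-identityʳ D))))
    (s≤s (scaled-digit-≤ D ε≤1))
    split-eq

  lows-agree : ∀ j → lookup es j ≡ ε
  lows-agree = weightedSum-01 E es pos es≤1 ε≤1 (proj₁ split-parts)

  highs-agree : ∀ j → lookup ys j ≡ ym
  highs-agree = weighted-digits-rigid E pos ys ys-digits dym (proj₂ split-parts)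

lemma1 : ∀ (n : ℕ) (E : Vec ℕ (suc n)) → Valid E →
    ∀ (xs : Vec ℕ (suc n)) (xm : ℕ) →
    (∀ i → B E (lookup xs i)) → B E xm →
    ¬ (∀ i → lookup xs i ≡ xm) →
    ¬ (sum (toList (zipWith _*_ E xs)) ≡ sum (toList E) * xm)
lemma1 n E (positive , _) xs xm xs-digits xm-digits not-all-equal balanced =
  not-all-equal (weighted-digits-rigid E positive xs xs-digits xm-digits balanced)
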